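{- Let $C$ be a cycle and $\mathcal{H}$ a family of vertex subsets of $C$ such that $(C,\mathcal{H})$ is $axax$-free. Let $H\in\mathcal{H}$ and let $u,v\in H$ be two non-consecutive vertices of $C$. Then every $H'\in\mathcal{H}$ with $H'\cap\mathrm{arc}(u,v)\neq\emptyset\neq H'\cap\mathrm{arc}(v,u)$ contains $u$ or $v$. Moreover, if $H\cap\mathrm{arc}(u,v)=\emptyset$, then every such $H'$ satisfies $H'\cap\mathrm{arc}[v,u]\subseteq H\cap\mathrm{arc}[v,u]$.
   Context: $C$ is oriented clockwise; $\mathrm{arc}[i,j]$ denotes the consecutive vertices $i,i+1,\dots,j$ in clockwise order, and $\mathrm{arc}(i,j)=\mathrm{arc}[i,j]\setminus\{i,j\}$. $(C,\mathcal{H})$ is $axax$-free if there are no $F,F'\in\mathcal{H}$ and four distinct vertices $a_1,x_1,a_2,x_2$ in this cyclic order on $C$ with $a_1,a_2\in F\setminus F'$ and $x_1,x_2\in F'$. -}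

module Defs where

open import Data.Nat using (ℕ; suc; _+_; _∸_; _<_; _≤_; NonZero)
open import Data.Nat.DivMod using (_%_)
open import Data.Fin using (Fin; toℕ)
open import Data.Fin.Subset using (Subset; _∈_; _∉_)
open import Data.Product using (_×_; Σ; ∃)
open import Relation.Binary.PropositionalEquality using (_≡_)
open import Relation.Nullary using (¬_)

-- The cycle C has vertex set Fin n (n ≥ 3), with edges i — i+1 (mod n);
-- clockwise order is the order of increasing index modulo n.

cdist : ∀ {n} .{{_ : NonZero n}} → Fin n → Fin n → ℕ
cdist {n} i j = (toℕ j + (n ∸ toℕ i)) % n

inOpenArc : ∀ {n} .{{_ : NonZero n}} → Fin n → Fin n → Fin n → Set
inOpenArc i j w = 0 < cdist i w × cdist i w < cdist i j

inClosedArc : ∀ {n} .{{_ : NonZero n}} → Fin n → Fin n → Fin n → Set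
inClosedArc i j w = cdist i w ≤ cdist i j

CyclicOrder4 : ∀ {n} .{{_ : NonZero n}} → Fin n → Fin n → Fin n → Fin n → Set
CyclicOrder4 a b c d = 0 < cdist a b × cdist a b < cdist a c × cdist a c < cdist a d

AxaxFree : ∀ {n} .{{_ : NonZero n}} → (Subset n → Set) → Set
AxaxFree {n} 𝓗 =
  ∀ (F F' : Subset n) → 𝓗 F → 𝓗 F' →
  ∀ (a₁ x₁ a₂ x₂ : Fin n) → CyclicOrder4 a₁ x₁ a₂ x₂ →
  ¬ (a₁ ∈ F × a₁ ∉ F' × a₂ ∈ F × a₂ ∉ F' × x₁ ∈ F' × x₂ ∈ F')

NonConsecutive : ∀ {n} .{{_ : NonZero n}} → Fin n → Fin n → Set
NonConsecutive {n} u v = 1 < cdist u v × cdist u v < n ∸ 1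

MeetsOpenArc : ∀ {n} .{{_ : NonZero n}} → Subset n → Fin n → Fin n → Set
MeetsOpenArc S i j = ∃ λ w → w ∈ S × inOpenArc i j w

-- Both parts are instances of the axax-free condition. If H' meets arc(u,v) in x and
-- arc(v,u) in y but misses u and v, then u, x, v, y is a forbidden pattern for (H, H').
-- If moreover H misses arc(u,v) and w ∈ arc[v,u] lies in H' but not in H, then w ≠ u, v,
-- and x, v, w, u is a forbidden pattern for (H', H). All order reasoning reduces to the
-- additivity of the clockwise distance along an arc.
module Submission where

open import Defs
open import Data.Nat using (ℕ; suc; _≤_; _<_; _+_; _∸_; NonZero)
open import Data.Nat.Properties
open import Data.Nat.DivMod using (_%_; m%n<n; n%n≡0; %-congˡ; %-distribˡ-+; [m+n]%n≡m%n;
  m<n⇒m%n≡m; m≤n⇒[n∸m]%m≡n%m)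
open import Data.Nat.Tactic.RingSolver using (solve-∀)
open import Data.Fin using (Fin; toℕ)
open import Data.Fin.Properties using (toℕ-injective; toℕ<n; toℕ≤n)
open import Data.Fin.Subset using (Subset; _∈_; _∉_)
open import Data.Fin.Subset.Properties using (_∈?_)
open import Data.Product using (_×_; _,_)
open import Data.Sum using (_⊎_; inj₁; inj₂)
open import Relation.Nullary using (yes; no; contradiction)
open import Relation.Binary.PropositionalEquality

m<n+n⇒m%n+n≡m : ∀ {m n} .{{_ : NonZero n}} → n ≤ m → m < n + n → m % n + n ≡ m
m<n+n⇒m%n+n≡m {m} {n} n≤m m<n+n = begin
  m % n + n        ≡⟨ cong (_+ n) (sym (m≤n⇒[n∸m]%m≡n%m n≤m)) ⟩
  (m ∸ n) % n + n  ≡⟨ cong (_+ n) (m<n⇒m%n≡m (+-cancelʳ-< n (m ∸ n) n m∸n+n<n+n)) ⟩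
  m ∸ n + n        ≡⟨ m∸n+n≡m n≤m ⟩
  m                ∎
  where
    open ≡-Reasoning
    m∸n+n<n+n : m ∸ n + n < n + n
    m∸n+n<n+n = subst (_< n + n) (sym (m∸n+n≡m n≤m)) m<n+n

m%n≡0⇒m≡n : ∀ {m n} .{{_ : NonZero n}} → m % n ≡ 0 → 0 < m → m < n + n → m ≡ n
m%n≡0⇒m≡n {m} {n} m%n≡0 0<m m<n+n with m <? n
... | yes m<n = contradiction (trans (sym (m<n⇒m%n≡m m<n)) m%n≡0) (>⇒≢ 0<m)
... | no m≮n = trans (sym (m<n+n⇒m%n+n≡m (≮⇒≥ m≮n) m<n+n)) (cong (_+ n) m%n≡0)

module _ {n : ℕ} .{{_ : NonZero n}} where

  cdist<n : (i j : Fin n) → cdist i j < n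
  cdist<n i j = m%n<n _ n

  cdist-refl : (i : Fin n) → cdist i i ≡ 0
  cdist-refl i = trans (%-congˡ (m+[n∸m]≡n (toℕ≤n i))) (n%n≡0 n)

  cdist-cocycle : (i j k : Fin n) → (cdist i j + cdist j k) % n ≡ cdist i k
  cdist-cocycle i j k = begin
    ((j̄ + i′) % n + (k̄ + j′) % n) % n  ≡⟨ %-distribˡ-+ (j̄ + i′) (k̄ + j′) n ⟨
    ((j̄ + i′) + (k̄ + j′)) % n          ≡⟨ %-congˡ (rearrange j̄ i′ k̄ j′) ⟩
    ((k̄ + i′) + (j̄ + j′)) % n          ≡⟨ %-congˡ (cong ((k̄ + i′) +_) (m+[n∸m]≡n (toℕ≤n j))) ⟩
    ((k̄ + i′) + n) % n                 ≡⟨ [m+n]%n≡m%n (k̄ + i′) n ⟩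
    (k̄ + i′) % n                       ∎
    where
      open ≡-Reasoning
      j̄ = toℕ j
      k̄ = toℕ k
      i′ = n ∸ toℕ i
      j′ = n ∸ toℕ j
      rearrange : ∀ a b c d → (a + b) + (c + d) ≡ (c + b) + (a + d)
      rearrange = solve-∀

  cdist≡0⇒≡ : {i j : Fin n} → cdist i j ≡ 0 → i ≡ j
  cdist≡0⇒≡ {i} {j} cdist≡0 = toℕ-injective (+-cancelʳ-≡ (n ∸ toℕ i) (toℕ i) (toℕ j) (begin
    toℕ i + (n ∸ toℕ i)  ≡⟨ m+[n∸m]≡n (toℕ≤n i) ⟩
    n                    ≡⟨ m%n≡0⇒m≡n cdist≡0 0<s s<n+n ⟨
    toℕ j + (n ∸ toℕ i)  ∎))
    where
      open ≡-Reasoning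
      0<s : 0 < toℕ j + (n ∸ toℕ i)
      0<s = <-≤-trans (m<n⇒0<n∸m (toℕ<n i)) (m≤n+m (n ∸ toℕ i) (toℕ j))
      s<n+n : toℕ j + (n ∸ toℕ i) < n + n
      s<n+n = +-mono-<-≤ (toℕ<n j) (m∸n≤m n (toℕ i))

  ≢⇒0<cdist : {i j : Fin n} → i ≢ j → 0 < cdist i j
  ≢⇒0<cdist i≢j = n≢0⇒n>0 (λ cdist≡0 → i≢j (cdist≡0⇒≡ cdist≡0))

  cdist-+ : (i j k : Fin n) → cdist i j + cdist j k < n → cdist i j + cdist j k ≡ cdist i k
  cdist-+ i j k s<n = trans (sym (m<n⇒m%n≡m s<n)) (cdist-cocycle i j k)

  cdist-+-≤ : (i j k : Fin n) → cdist i j ≤ cdist i k → cdist i j + cdist j k ≡ cdist i k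
  cdist-+-≤ i j k ij≤ik with cdist i j + cdist j k <? n
  ... | yes s<n = cdist-+ i j k s<n
  ... | no s≮n = contradiction ij≤ik (<⇒≱ (+-cancelʳ-< n (cdist i k) (cdist i j) ik+n<ij+n))
    where
      ik+n<ij+n : cdist i k + n < cdist i j + n
      ik+n<ij+n = begin-strict
        cdist i k + n              ≡⟨ cong (_+ n) (cdist-cocycle i j k) ⟨
        (cdist i j + cdist j k) % n + n
          ≡⟨ m<n+n⇒m%n+n≡m (≮⇒≥ s≮n) (+-mono-< (cdist<n i j) (cdist<n j k)) ⟩
        cdist i j + cdist j k      <⟨ +-monoʳ-< (cdist i j) (cdist<n j k) ⟩
        cdist i j + n              ∎
        where open ≤-Reasoning

  cdist-+-swap : (i j : Fin n) → 0 < cdist i j → cdist i j + cdist j i ≡ n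
  cdist-+-swap i j 0<ij = m%n≡0⇒m≡n (trans (cdist-cocycle i j i) (cdist-refl i))
    (<-≤-trans 0<ij (m≤m+n (cdist i j) (cdist j i)))
    (+-mono-< (cdist<n i j) (cdist<n j i))

  openArcs⇒CyclicOrder4 : (u v x y : Fin n) → inOpenArc u v x → inOpenArc v u y →
                          CyclicOrder4 u x v y
  openArcs⇒CyclicOrder4 u v x y (0<ux , ux<uv) (0<vy , vy<vu) = 0<ux , ux<uv , uv<uy
    where
      uv+vy<n : cdist u v + cdist v y < n
      uv+vy<n = subst (cdist u v + cdist v y <_) (cdist-+-swap u v (<-trans 0<ux ux<uv))
                  (+-monoʳ-< (cdist u v) vy<vu)
      uv<uy : cdist u v < cdist u y
      uv<uy = subst (cdist u v <_) (cdist-+ u v y uv+vy<n) (m<m+n (cdist u v) 0<vy)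

  CyclicOrder4-rotate : (a b c d : Fin n) → CyclicOrder4 a b c d → CyclicOrder4 b c d a
  CyclicOrder4-rotate a b c d (0<ab , ab<ac , ac<ad) =
    +-cancelˡ-< (cdist a b) 0 (cdist b c)
      (subst₂ _<_ (sym (+-identityʳ (cdist a b))) (sym ab+bc) ab<ac) ,
    +-cancelˡ-< (cdist a b) (cdist b c) (cdist b d) (subst₂ _<_ (sym ab+bc) (sym ab+bd) ac<ad) ,
    +-cancelˡ-< (cdist a b) (cdist b d) (cdist b a)
      (subst₂ _<_ (sym ab+bd) (sym ab+ba) (cdist<n a d))
    where
      ab+bc : cdist a b + cdist b c ≡ cdist a c
      ab+bc = cdist-+-≤ a b c (<⇒≤ ab<ac)
      ab+bd : cdist a b + cdist b d ≡ cdist a d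
      ab+bd = cdist-+-≤ a b d (<⇒≤ (<-trans ab<ac ac<ad))
      ab+ba : cdist a b + cdist b a ≡ n
      ab+ba = cdist-+-swap a b 0<ab

  closedArc⇒openArc : {i j w : Fin n} → i ≢ w → w ≢ j →
                      inClosedArc i j w → inOpenArc i j w
  closedArc⇒openArc {i} {j} {w} i≢w w≢j iw≤ij = ≢⇒0<cdist i≢w , iw<ij
    where
      iw<ij : cdist i w < cdist i j
      iw<ij = subst (cdist i w <_) (cdist-+-≤ i w j iw≤ij) (m<m+n (cdist i w) (≢⇒0<cdist w≢j))

proposition3 : (n : ℕ) → 2 ≤ n → (𝓗 : Subset (suc n) → Set) →
    AxaxFree 𝓗 →
    (H : Subset (suc n)) → 𝓗 H → (u v : Fin (suc n)) → u ∈ H → v ∈ H →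
    NonConsecutive u v →
    ((H' : Subset (suc n)) → 𝓗 H' → MeetsOpenArc H' u v → MeetsOpenArc H' v u →
      (u ∈ H' ⊎ v ∈ H'))
    ×
    ((∀ w → inOpenArc u v w → w ∉ H) →
      (H' : Subset (suc n)) → 𝓗 H' → MeetsOpenArc H' u v → MeetsOpenArc H' v u →
      ∀ w → inClosedArc v u w → w ∈ H' → w ∈ H)
proposition3 n _ 𝓗 axax H H∈𝓗 u v u∈H v∈H _ = separating , confined
  where
    separating : (H' : Subset (suc n)) → 𝓗 H' → MeetsOpenArc H' u v → MeetsOpenArc H' v u →
                 u ∈ H' ⊎ v ∈ H'
    separating H' H'∈𝓗 (x , x∈H' , x∈uv) (y , y∈H' , y∈vu) with u ∈? H' | v ∈? H'
    ... | yes u∈H' | _        = inj₁ u∈H'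
    ... | no _     | yes v∈H' = inj₂ v∈H'
    ... | no u∉H'  | no v∉H'  = contradiction (u∈H , u∉H' , v∈H , v∉H' , x∈H' , y∈H')
      (axax H H' H∈𝓗 H'∈𝓗 u x v y (openArcs⇒CyclicOrder4 u v x y x∈uv y∈vu))

    confined : (∀ w → inOpenArc u v w → w ∉ H) →
               (H' : Subset (suc n)) → 𝓗 H' → MeetsOpenArc H' u v → MeetsOpenArc H' v u →
               ∀ w → inClosedArc v u w → w ∈ H' → w ∈ H
    confined H∩uv≡∅ H' H'∈𝓗 (x , x∈H' , x∈uv) _ w w∈[vu] w∈H' with w ∈? H
    ... | yes w∈H = w∈H
    ... | no w∉H  = contradiction (x∈H' , H∩uv≡∅ x x∈uv , w∈H' , w∉H , v∈H , u∈H)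
      (axax H' H H'∈𝓗 H∈𝓗 x v w u x-v-w-u)
      where
        w∈vu : inOpenArc v u w
        w∈vu = closedArc⇒openArc (λ v≡w → w∉H (subst (_∈ H) v≡w v∈H))
                                 (λ w≡u → w∉H (subst (_∈ H) (sym w≡u) u∈H)) w∈[vu]
        x-v-w-u : CyclicOrder4 x v w u
        x-v-w-u = CyclicOrder4-rotate u x v w (openArcs⇒CyclicOrder4 u v x w x∈uv w∈vu)
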